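{- Let $u,v\in\mathfrak S_n$. If there exists a reduced Rothe pipe dream of $u$ with exit permutation $v$, then $u\le v$ in Bruhat order.
   Context: Permutations $u=u_1\cdots u_n\in\mathfrak S_n$ are written in one-line notation; $\le$ is the Bruhat order. Use an $n\times n$ array of boxes, box $(i,j)$ lying in row $i$ (counted from the top) and column $j$ (counted from the left). Tiles: empty; horizontal pipe (segment joining the midpoints of the left and right edges); vertical pipe (segment joining the midpoints of the top and bottom edges); pivot elbow (a single arc joining the midpoint of the top edge to the midpoint of the right edge); cross (a horizontal and a vertical pipe); elbow (two arcs, one joining the top-edge midpoint to the right-edge midpoint, the other joining the left-edge midpoint to the bottom-edge midpoint). The pivots of $u$ are the boxes $(i,u_i)$. A Rothe pipe dream of $u$ is a tiling of the array by these tiles such that: (i) there are $n$ pipes, each beginning at the top edge of the array and ending at the right edge; (ii) each pivot $(i,u_i)$ is a pivot elbow; (iii) each box $(i,j)$ with $u^{ -1}(j)<i$ and $j<u_i$ is empty; (iv) each box $(i,j)$ with $u^{ -1}(j)<i$ and $j>u_i$ is a horizontal pipe; (v) each box $(i,j)$ with $u^{ -1}(j)>i$ and $j<u_i$ is a vertical pipe. (Thus the boxes $(i,j)$ with $j>u_i$ and $u^{ -1}(j)>i$ are exactly those tiled by crosses or elbows.) It is reduced if no two pipes cross each other (pass through a common cross tile) more than once. The pipe entering at the top of column $j$ is labelled $j$; the exit permutation $v$ of a reduced Rothe pipe dream is defined by letting $v_i$ be the label of the pipe leaving the right edge of the array in row $i$. -}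

module Defs where

open import Data.Nat using (ℕ; zero; suc; _*_; _<_)
open import Data.Bool using (Bool; true; false; _∧_; if_then_else_)
open import Data.Fin using (Fin; zero; suc; toℕ) renaming (_<_ to _<ᶠ_)
open import Data.Fin.Properties using () renaming (_<?_ to _<ᶠ?_)
open import Data.Fin.Permutation using (Permutation′; _⟨$⟩ʳ_; _⟨$⟩ˡ_)
open import Data.Fin.Permutation.Components using (transpose)
open import Data.List using (List; []; _∷_; map; allFin)
open import Data.Nat.ListAction using (sum)
open import Data.Maybe using (Maybe; just; nothing)
open import Data.Product using (_×_; _,_; proj₁; proj₂; ∃; ∃-syntax)
open import Relation.Nullary using (does; ¬_)
open import Relation.Binary.PropositionalEquality using (_≡_)

inv : ∀ {n} → (Fin n → Fin n) → ℕ
inv {n} w = sum (map (λ i → sum (map (λ j →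
  if does (i <ᶠ? j) ∧ does (w j <ᶠ? w i) then 1 else 0) (allFin n))) (allFin n))

-- Bruhat step: w = u · t for a transposition t = (i j) (i < j) with ℓ(u) < ℓ(w).
-- (transpose i j is the transposition of positions i and j; w k = u (t k).)
BruhatStep : ∀ {n} → (Fin n → Fin n) → (Fin n → Fin n) → Set
BruhatStep {n} u w =
  ∃[ i ] ∃[ j ] (i <ᶠ j × (∀ k → w k ≡ u (transpose i j k)) × inv u < inv w)

data _≤ᴮ_ {n : ℕ} : (Fin n → Fin n) → (Fin n → Fin n) → Set where
  ≤ᴮ-refl : ∀ {u v} → (∀ k → u k ≡ v k) → u ≤ᴮ v
  ≤ᴮ-step : ∀ {u w v} → BruhatStep u w → w ≤ᴮ v → u ≤ᴮ v

_≤Bruhat_ : ∀ {n} → Permutation′ n → Permutation′ n → Set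
u ≤Bruhat v = (u ⟨$⟩ʳ_) ≤ᴮ (v ⟨$⟩ʳ_)

data Tile : Set where
  empty horiz vert pivotElbow cross elbow : Tile

hasTop hasBottom hasLeft hasRight : Tile → Bool
hasTop empty = false
hasTop horiz = false
hasTop vert = true
hasTop pivotElbow = true
hasTop cross = true
hasTop elbow = true
hasBottom empty = false
hasBottom horiz = false
hasBottom vert = true
hasBottom pivotElbow = false
hasBottom cross = true
hasBottom elbow = true
hasLeft empty = false
hasLeft horiz = true
hasLeft vert = false
hasLeft pivotElbow = false
hasLeft cross = true
hasLeft elbow = true
hasRight empty = false
hasRight horiz = true
hasRight vert = false
hasRight pivotElbow = true
hasRight cross = true
hasRight elbow = true

-- A tiling of the n×n array: box (i , j) = row i from the top, column j from the left.
Tiling : ℕ → Set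
Tiling n = Fin n → Fin n → Tile

inc : ∀ {n} → Fin n → Maybe (Fin n)
inc {suc zero} zero = nothing
inc {suc (suc n)} zero = just (suc zero)
inc {suc (suc n)} (suc i) = Data.Maybe.map suc (inc i)
  where import Data.Maybe

data Side : Set where
  fromTop fromLeft : Side

data Dir : Set where
  goDown goRight : Dir

move : Tile → Side → Maybe Dir
move vert fromTop = just goDown
move cross fromTop = just goDown
move pivotElbow fromTop = just goRight
move elbow fromTop = just goRight
move horiz fromLeft = just goRight
move cross fromLeft = just goRight
move elbow fromLeft = just goDown
move _ _ = nothing

data Outcome (n : ℕ) : Set where
  exitsRight : Fin n → Outcome n   -- leaves the right edge of the array in this row
  exitsBottom : Outcome n
  dangling : Outcome n
  outOfFuel : Outcome n

walk : ∀ {n} → ℕ → Tiling n → Fin n → Fin n → Side → List (Fin n × Fin n) × Outcome n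
walk zero D i j s = [] , outOfFuel
walk (suc f) D i j s with move (D i j) s
... | nothing = ((i , j) ∷ []) , dangling
... | just goDown with inc i
...   | just i' = let r = walk f D i' j fromTop in ((i , j) ∷ proj₁ r) , proj₂ r
...   | nothing = ((i , j) ∷ []) , exitsBottom
walk (suc f) D i j s | just goRight with inc j
...   | just j' = let r = walk f D i j' fromLeft in ((i , j) ∷ proj₁ r) , proj₂ r
...   | nothing = ((i , j) ∷ []) , exitsRight i

topRow : ∀ {n} → Fin n → Fin n
topRow {suc n} _ = zero

-- the pipe entering at the top of column j (pipes move only down/right, so
-- 2n steps are more than enough to follow it to the boundary)
pipe : ∀ {n} → Tiling n → Fin n → List (Fin n × Fin n) × Outcome n
pipe {n} D j = walk (2 * n) D (topRow j) j fromTop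

_passes_ : ∀ {n} {D : Tiling n} → Fin n → Fin n × Fin n → Set
_passes_ {D = D} a c = c Data.List.Membership.Propositional.∈ proj₁ (pipe D a)
  where import Data.List.Membership.Propositional

PipesOK : ∀ {n} → Tiling n → Set
PipesOK {n} D =
    (∀ i j j' → inc j ≡ just j' → hasRight (D i j) ≡ hasLeft (D i j'))
  × (∀ i i' j → inc i ≡ just i' → hasBottom (D i j) ≡ hasTop (D i' j))
  × (∀ i j → toℕ j ≡ 0 → hasLeft (D i j) ≡ false)
  × (∀ i j → inc i ≡ nothing → hasBottom (D i j) ≡ false)
  × (∀ j → ∃[ r ] proj₂ (pipe D j) ≡ exitsRight r)

-- Rothe pipe dream of u (u_i = u ⟨$⟩ʳ i, u⁻¹(j) = u ⟨$⟩ˡ j)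
IsRothePipeDream : ∀ {n} → Permutation′ n → Tiling n → Set
IsRothePipeDream u D =
    PipesOK D
  × (∀ i → D i (u ⟨$⟩ʳ i) ≡ pivotElbow)
  × (∀ i j → u ⟨$⟩ˡ j <ᶠ i → j <ᶠ u ⟨$⟩ʳ i → D i j ≡ empty)
  × (∀ i j → u ⟨$⟩ˡ j <ᶠ i → u ⟨$⟩ʳ i <ᶠ j → D i j ≡ horiz)
  × (∀ i j → i <ᶠ u ⟨$⟩ˡ j → j <ᶠ u ⟨$⟩ʳ i → D i j ≡ vert)

Reduced : ∀ {n} → Tiling n → Set
Reduced {n} D = ∀ (a b : Fin n) → ¬ a ≡ b → ∀ (c c' : Fin n × Fin n) →
  D (proj₁ c) (proj₂ c) ≡ cross → D (proj₁ c') (proj₂ c') ≡ cross →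
  _passes_ {D = D} a c → _passes_ {D = D} b c →
  _passes_ {D = D} a c' → _passes_ {D = D} b c' → c ≡ c'

HasExitPermutation : ∀ {n} → Tiling n → Permutation′ n → Set
HasExitPermutation D v = ∀ i → proj₂ (pipe D (v ⟨$⟩ʳ i)) ≡ exitsRight i

{-# OPTIONS --safe #-}
-- Write w[r, k] = #{a ≤ r : w a ≥ k}. Tableau criterion: u ≤ v in Bruhat order as soon as
-- u[r, k] ≤ v[r, k] for all r, k. Indeed, if u ≠ v let I be the first position where they differ;
-- then u I < v I, and swapping I with the first later position j such that u I < u j ≤ v I raises
-- the length while keeping the inequalities, because it raises u[r, k] by one exactly on the window
-- I ≤ r < j, u I < k ≤ u j, where v[r, k] already exceeds u[r, k].
--
-- A Rothe pipe dream of u with exit permutation v satisfies these inequalities. The pipe v b, for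
-- b > r and v b ≥ k, starts in column v b and must leave row r downwards through some box (r , c)
-- with c ≥ v b; in a Rothe pipe dream such a box lies above the pivot (a , u a) of its column, so
-- a > r and u a = c ≥ k. Pipes leaving through the same edge coincide from then on, so
-- #{b > r : v b ≥ k} ≤ #{a > r : u a ≥ k}, which is u[r, k] ≤ v[r, k] because
-- #{a : w a ≥ k} does not depend on the permutation w.
module Submission where

open import Defs
open import Level using (Level; 0ℓ)
open import Algebra.Properties.CommutativeSemigroup using (interchange; x∙yz≈y∙xz)
open import Data.Bool using (true; if_then_else_)
open import Data.Fin as Fin using (Fin; toℕ; zero; suc)
open import Data.Fin.Permutation using (Permutation′; _⟨$⟩ʳ_; _⟨$⟩ˡ_; inverseˡ; inverseʳ; _∘ₚ_)
import Data.Fin.Permutation as Perm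
open import Data.Fin.Permutation.Components using (transpose)
import Data.Fin.Properties as Finₚ
open import Data.Fin.Properties
  using (_≟_; _<?_; _≤?_; all?; <-irrefl; <-asym; <-trans; toℕ-injective; toℕ-inject; toℕ-fromℕ<;
         ¬∀⟶∃¬-smallest)
open import Data.List using (List; []; _∷_; _++_; map; length; cartesianProduct; allFin)
open import Data.List.Membership.Propositional using (_∈_)
open import Data.List.Membership.Propositional.Properties using (∈-allFin; ∈-cartesianProduct⁺)
open import Data.List.Properties using (map-++; map-∘)
open import Data.List.Relation.Unary.All using (All; []; _∷_; lookup)
open import Data.List.Relation.Unary.Any using (here; there)
open import Data.List.Relation.Unary.Unique.Propositional using (Unique; _∷_)
open import Data.List.Relation.Unary.Unique.Propositional.Properties
  using (allFin⁺; cartesianProduct⁺)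
open import Data.Maybe using (just; nothing)
open import Data.Nat as ℕ using (ℕ; zero; suc; _+_; _*_; _≤_; _<_; z≤n; s≤s)
open import Data.Nat.ListAction using (sum)
open import Data.Nat.ListAction.Properties using (sum-++)
open import Data.Nat.Properties
  using (module ≤-Reasoning; ≤-refl; ≤-trans; ≤-antisym; <⇒≤; <⇒≱; ≮⇒≥; ≰⇒>; n≮n; n<1+n; n≤1+n;
         m≤n⇒m≤1+n; m≤n+m; ≤-<-trans; <-≤-trans; +-assoc; +-suc; +-identityʳ; +-mono-≤; +-monoˡ-≤;
         +-monoʳ-≤; +-cancelʳ-≤; +-commutativeSemigroup)
open import Data.Product using (_×_; _,_; proj₁; proj₂; ∃-syntax)
open import Data.Product.Properties using (≡-dec)
open import Function using (_∘_; Injection)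
open import Function.Properties.Inverse using (↔⇒↣)
open import Relation.Binary.Definitions using (DecidableEquality; tri<; tri≈; tri>)
open import Relation.Binary.PropositionalEquality
  using (_≡_; _≢_; refl; sym; trans; cong; cong₂; subst; subst₂; ≢-sym; module ≡-Reasoning)
open import Relation.Nullary using (Dec; yes; no; does; ¬_; ¬?; _×-dec_; contradiction)
open import Relation.Nullary.Decidable using (dec-true; dec-false; decidable-stable)
open import Relation.Unary using (Pred; Decidable; _⊆_; _≐_)
open import Relation.Unary.Properties using (∁?; _∩?_)

private
  variable
    a b p q r : Level
    A : Set a
    B : Set b

indicator : {P : Set p} → Dec P → ℕ
indicator P? = if does P? then 1 else 0

indicator-yes : {P : Set p} (P? : Dec P) → P → indicator P? ≡ 1
indicator-yes (yes _) _ = refl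
indicator-yes (no ¬p) p = contradiction p ¬p

indicator-no : {P : Set p} (P? : Dec P) → ¬ P → indicator P? ≡ 0
indicator-no (yes p) ¬p = contradiction p ¬p
indicator-no (no _)  _  = refl

indicator-split : {P : Set p} {Q : Set q} (P? : Dec P) (Q? : Dec Q) →
  indicator P? ≡ indicator (Q? ×-dec P?) + indicator (¬? Q? ×-dec P?)
indicator-split (yes _) (yes _) = refl
indicator-split (yes _) (no _)  = refl
indicator-split (no _)  (yes _) = refl
indicator-split (no _)  (no _)  = refl

indicator-exchange : ∀ {ℓa ℓb ℓc ℓd} {A : Set ℓa} {B : Set ℓb} {C : Set ℓc} {D : Set ℓd}
  (a? : Dec A) (b? : Dec B) (c? : Dec C) (d? : Dec D) → (B → A) → (C → D) →
  indicator (a? ×-dec d?) + indicator (b? ×-dec c?)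
    ≡ indicator (a? ×-dec ¬? b? ×-dec ¬? c? ×-dec d?)
      + (indicator (a? ×-dec c?) + indicator (b? ×-dec d?))
indicator-exchange (no _)  (no _)  _       _       _   _   = refl
indicator-exchange (no ¬a) (yes b) _       _       b⇒a _   = contradiction (b⇒a b) ¬a
indicator-exchange (yes _) _       (yes c) (no ¬d) _   c⇒d = contradiction (c⇒d c) ¬d
indicator-exchange (yes _) (no _)  (no _)  (no _)  _   _   = refl
indicator-exchange (yes _) (no _)  (no _)  (yes _) _   _   = refl
indicator-exchange (yes _) (no _)  (yes _) (yes _) _   _   = refl
indicator-exchange (yes _) (yes _) (no _)  (no _)  _   _   = refl
indicator-exchange (yes _) (yes _) (no _)  (yes _) _   _   = refl
indicator-exchange (yes _) (yes _) (yes _) (yes _) _   _   = refl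

count : {P : Pred A p} → Decidable P → List A → ℕ
count P? xs = sum (map (λ x → indicator (P? x)) xs)

module _ {P : Pred A p} (P? : Decidable P) where

  count-≤-length : ∀ xs → count P? xs ≤ length xs
  count-≤-length []       = z≤n
  count-≤-length (x ∷ xs) with P? x
  ... | yes _ = s≤s (count-≤-length xs)
  ... | no  _ = m≤n⇒m≤1+n (count-≤-length xs)

  count-++ : ∀ xs ys → count P? (xs ++ ys) ≡ count P? xs + count P? ys
  count-++ xs ys =
    trans (cong sum (map-++ _ xs ys)) (sum-++ (map (λ x → indicator (P? x)) xs) _)

  count-map : (f : B → A) → ∀ xs → count P? (map f xs) ≡ count (P? ∘ f) xs
  count-map f xs = cong sum (sym (map-∘ xs))

count-cartesianProduct : ∀ {C : Set r} {P : Pred (B × C) p} (P? : Decidable P) xs ys →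
  count P? (cartesianProduct xs ys) ≡ sum (map (λ x → count (λ y → P? (x , y)) ys) xs)
count-cartesianProduct P? []       ys = refl
count-cartesianProduct P? (x ∷ xs) ys = begin
  count P? (map (x ,_) ys ++ cartesianProduct xs ys)
    ≡⟨ count-++ P? (map (x ,_) ys) _ ⟩
  count P? (map (x ,_) ys) + count P? (cartesianProduct xs ys)
    ≡⟨ cong₂ _+_ (count-map P? (x ,_) ys) (count-cartesianProduct P? xs ys) ⟩
  count (λ y → P? (x , y)) ys + sum (map (λ x → count (λ y → P? (x , y)) ys) xs) ∎
  where open ≡-Reasoning

module _ {P : Pred A p} {Q : Pred A q} (P? : Decidable P) (Q? : Decidable Q) where

  count-mono : P ⊆ Q → ∀ xs → count P? xs ≤ count Q? xs
  count-mono P⊆Q []       = z≤n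
  count-mono P⊆Q (x ∷ xs) with P? x | Q? x
  ... | yes _  | yes _  = s≤s (count-mono P⊆Q xs)
  ... | yes px | no ¬qx = contradiction (P⊆Q px) ¬qx
  ... | no _   | yes _  = m≤n⇒m≤1+n (count-mono P⊆Q xs)
  ... | no _   | no _   = count-mono P⊆Q xs

  count-split : ∀ xs → count P? xs ≡ count (Q? ∩? P?) xs + count (∁? Q? ∩? P?) xs
  count-split []       = refl
  count-split (x ∷ xs) = begin
    indicator (P? x) + count P? xs
      ≡⟨ cong₂ _+_ (indicator-split (P? x) (Q? x)) (count-split xs) ⟩
    (indicator ((Q? ∩? P?) x) + indicator ((∁? Q? ∩? P?) x))
      + (count (Q? ∩? P?) xs + count (∁? Q? ∩? P?) xs)
      ≡⟨ interchange +-commutativeSemigroup (indicator ((Q? ∩? P?) x)) _ (count (Q? ∩? P?) xs) _ ⟩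
    count (Q? ∩? P?) (x ∷ xs) + count (∁? Q? ∩? P?) (x ∷ xs) ∎
    where open ≡-Reasoning

count-cong : {P : Pred A p} {Q : Pred A q} (P? : Decidable P) (Q? : Decidable Q) →
  P ≐ Q → ∀ xs → count P? xs ≡ count Q? xs
count-cong P? Q? (P⊆Q , Q⊆P) xs =
  ≤-antisym (count-mono P? Q? P⊆Q xs) (count-mono Q? P? Q⊆P xs)

module Removal (_≟_ : DecidableEquality A) where

  infixl 7 _∖?_
  _∖?_ : {P : Pred A p} → Decidable P → (y : A) → Decidable (λ x → x ≢ y × P x)
  (P? ∖? y) x = ¬? (x ≟ y) ×-dec P? x

  indicator-∖?-self : {P : Pred A p} (P? : Decidable P) → ∀ y → indicator ((P? ∖? y) y) ≡ 0
  indicator-∖?-self P? y with y ≟ y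
  ... | yes _   = refl
  ... | no y≢y = contradiction refl y≢y

  indicator-∖?-other : {P : Pred A p} (P? : Decidable P) → ∀ {x y} → x ≢ y →
    indicator ((P? ∖? y) x) ≡ indicator (P? x)
  indicator-∖?-other P? {x} {y} x≢y with x ≟ y
  ... | yes x≡y = contradiction x≡y x≢y
  ... | no _    = refl

  count-∖?-∉ : {P : Pred A p} (P? : Decidable P) → ∀ {y xs} → All (y ≢_) xs →
    count (P? ∖? y) xs ≡ count P? xs
  count-∖?-∉ P? []             = refl
  count-∖?-∉ P? (y≢x ∷ y∉xs) =
    cong₂ _+_ (indicator-∖?-other P? (≢-sym y≢x)) (count-∖?-∉ P? y∉xs)

  count-remove : {P : Pred A p} (P? : Decidable P) → ∀ {y xs} → Unique xs → y ∈ xs →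
    count P? xs ≡ indicator (P? y) + count (P? ∖? y) xs
  count-remove P? {y} (y∉xs ∷ _) (here refl) =
    cong (indicator (P? y) +_)
      (sym (cong₂ _+_ (indicator-∖?-self P? y) (count-∖?-∉ P? y∉xs)))
  count-remove P? {y} {x ∷ xs} (x∉xs ∷ xs!) (there y∈xs) = begin
    indicator (P? x) + count P? xs
      ≡⟨ cong (indicator (P? x) +_) (count-remove P? xs! y∈xs) ⟩
    indicator (P? x) + (indicator (P? y) + count (P? ∖? y) xs)
      ≡⟨ x∙yz≈y∙xz +-commutativeSemigroup (indicator (P? x)) (indicator (P? y)) _ ⟩
    indicator (P? y) + (indicator (P? x) + count (P? ∖? y) xs)
      ≡⟨ cong (λ m → indicator (P? y) + (m + count (P? ∖? y) xs))
              (sym (indicator-∖?-other P? (lookup x∉xs y∈xs))) ⟩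
    indicator (P? y) + count (P? ∖? y) (x ∷ xs) ∎
    where open ≡-Reasoning

  count-remove₂ : {P : Pred A p} (P? : Decidable P) → ∀ {y z xs} →
    Unique xs → y ∈ xs → z ∈ xs → z ≢ y →
    count P? xs ≡ indicator (P? y) + (indicator (P? z) + count (P? ∖? y ∖? z) xs)
  count-remove₂ P? {y} {z} {xs} xs! y∈xs z∈xs z≢y = begin
    count P? xs
      ≡⟨ count-remove P? xs! y∈xs ⟩
    indicator (P? y) + count (P? ∖? y) xs
      ≡⟨ cong (indicator (P? y) +_) (count-remove (P? ∖? y) xs! z∈xs) ⟩
    indicator (P? y) + (indicator ((P? ∖? y) z) + count (P? ∖? y ∖? z) xs)
      ≡⟨ cong (λ m → indicator (P? y) + (m + count (P? ∖? y ∖? z) xs))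
              (indicator-∖?-other P? z≢y) ⟩
    indicator (P? y) + (indicator (P? z) + count (P? ∖? y ∖? z) xs) ∎
    where open ≡-Reasoning

  count-remove⁺ : {P : Pred A p} (P? : Decidable P) → ∀ {y xs} → Unique xs → y ∈ xs → P y →
    count P? xs ≡ suc (count (P? ∖? y) xs)
  count-remove⁺ P? {y} {xs} xs! y∈xs py =
    trans (count-remove P? xs! y∈xs) (cong (_+ count (P? ∖? y) xs) (indicator-yes (P? y) py))

module _ {P : Pred A p} (P? : Decidable P) (_≟_ : DecidableEquality B)
         (R : A → B → Set r) (R-injective : ∀ {x x′ y} → R x y → R x′ y → x ≡ x′) where

  open Removal _≟_

  count-≤-by-injection : ∀ {xs ys} → Unique xs → Unique ys →
    {Q : Pred B q} (Q? : Decidable Q) →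
    (∀ {x} → x ∈ xs → P x → ∃[ y ] y ∈ ys × Q y × R x y) →
    count P? xs ≤ count Q? ys
  count-≤-by-injection {xs = []}     _            _   _  _     = z≤n
  count-≤-by-injection {xs = x ∷ xs} {ys} (x∉xs ∷ xs!) ys! {Q} Q? image with P? x
  ... | no _   = count-≤-by-injection xs! ys! Q? (λ x′∈xs → image (there x′∈xs))
  ... | yes px with y , y∈ys , qy , Rxy ← image (here refl) px = begin
    suc (count P? xs)         ≤⟨ s≤s (count-≤-by-injection xs! ys! (Q? ∖? y) image′) ⟩
    suc (count (Q? ∖? y) ys)  ≡⟨ count-remove⁺ Q? ys! y∈ys qy ⟨
    count Q? ys               ∎
    where
    open ≤-Reasoning
    image′ : ∀ {x′} → x′ ∈ xs → P x′ → ∃[ y′ ] y′ ∈ ys × (y′ ≢ y × Q y′) × R x′ y′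
    image′ x′∈xs px′ with y′ , y′∈ys , qy′ , Rx′y′ ← image (there x′∈xs) px′ =
      y′ , y′∈ys , ((λ { refl → lookup x∉xs x′∈xs (R-injective Rxy Rx′y′) }) , qy′) , Rx′y′

count-permute : ∀ {n} (σ : Permutation′ n) {P : Pred (Fin n) p} (P? : Decidable P) →
  count (P? ∘ (σ ⟨$⟩ʳ_)) (allFin n) ≡ count P? (allFin n)
count-permute {n = n} σ {P} P? = ≤-antisym
  (count-≤-by-injection (P? ∘ (σ ⟨$⟩ʳ_)) _≟_ (λ a b → σ ⟨$⟩ʳ a ≡ b)
     (λ { refl e → Injection.injective (↔⇒↣ σ) (sym e) })
     (allFin⁺ n) (allFin⁺ n) P? (λ {a} _ p → σ ⟨$⟩ʳ a , ∈-allFin _ , p , refl))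
  (count-≤-by-injection P? _≟_ (λ b a → σ ⟨$⟩ʳ a ≡ b) (λ { refl refl → refl })
     (allFin⁺ n) (allFin⁺ n) (P? ∘ (σ ⟨$⟩ʳ_))
     (λ {b} _ p → σ ⟨$⟩ˡ b , ∈-allFin _ , subst P (sym (inverseʳ σ)) p , inverseʳ σ))

least-counterexample : ∀ {n} {P : Pred (Fin n) p} → Decidable P →
  ¬ (∀ a → P a) → ∃[ a ] ¬ P a × (∀ {b} → b Fin.< a → P b)
least-counterexample {P = P} P? ¬∀P
  with a , ¬Pa , P-below ← ¬∀⟶∃¬-smallest _ P P? ¬∀P =
  a , ¬Pa , λ b<a → subst P (toℕ-injective (trans (toℕ-inject _) (toℕ-fromℕ< b<a)))
                              (P-below (Fin.fromℕ< b<a))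

module _ {n} (i j : Fin n) where

  transpose-matchˡ : transpose i j i ≡ j
  transpose-matchˡ rewrite dec-true (i ≟ i) refl = refl

  transpose-matchʳ : transpose i j j ≡ i
  transpose-matchʳ with j ≟ i
  ... | yes j≡i = j≡i
  ... | no _ rewrite dec-true (j ≟ j) refl = refl

  transpose-apart : ∀ {k} → k ≢ i → k ≢ j → transpose i j k ≡ k
  transpose-apart {k} k≢i k≢j rewrite dec-false (k ≟ i) k≢i | dec-false (k ≟ j) k≢j = refl

  data TransposeView : Fin n → Set where
    at-i  : TransposeView i
    at-j  : TransposeView j
    apart : ∀ {k} → k ≢ i → k ≢ j → TransposeView k

  transposeView : ∀ k → TransposeView k
  transposeView k with k ≟ i | k ≟ j
  ... | yes refl | _        = at-i
  ... | no _     | yes refl = at-j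
  ... | no k≢i   | no k≢j   = apart k≢i k≢j

  transpose-involutive : ∀ k → transpose i j (transpose i j k) ≡ k
  transpose-involutive k with transposeView k
  ... | at-i = trans (cong (transpose i j) transpose-matchˡ) transpose-matchʳ
  ... | at-j = trans (cong (transpose i j) transpose-matchʳ) transpose-matchˡ
  ... | apart k≢i k≢j =
    trans (cong (transpose i j) (transpose-apart k≢i k≢j)) (transpose-apart k≢i k≢j)

positionPairs : ∀ n → List (Fin n × Fin n)
positionPairs n = cartesianProduct (allFin n) (allFin n)

positionPairs-unique : ∀ n → Unique (positionPairs n)
positionPairs-unique n = cartesianProduct⁺ (allFin⁺ n) (allFin⁺ n)

∈-positionPairs : ∀ {n} (ab : Fin n × Fin n) → ab ∈ positionPairs n
∈-positionPairs (a , b) = ∈-cartesianProduct⁺ (∈-allFin a) (∈-allFin b)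

_≟ᵖ_ : ∀ {n} → DecidableEquality (Fin n × Fin n)
_≟ᵖ_ = ≡-dec _≟_ _≟_

Inversion : ∀ {n} → (Fin n → Fin n) → Pred (Fin n × Fin n) 0ℓ
Inversion w (a , b) = a Fin.< b × w b Fin.< w a

inversion? : ∀ {n} (w : Fin n → Fin n) → Decidable (Inversion w)
inversion? w (a , b) = (a <? b) ×-dec (w b <? w a)

inv≡count-inversions : ∀ {n} (w : Fin n → Fin n) →
  inv w ≡ count (inversion? w) (positionPairs n)
inv≡count-inversions {n} w = sym (count-cartesianProduct (inversion? w) (allFin n) (allFin n))

inv-≤-length : ∀ {n} (w : Fin n → Fin n) → inv w ≤ length (positionPairs n)
inv-≤-length {n} w = subst (_≤ length (positionPairs n)) (sym (inv≡count-inversions w))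
  (count-≤-length (inversion? w) (positionPairs n))

module _ {n} (w : Fin n → Fin n) {i j : Fin n} (i<j : i Fin.< j) (wi<wj : w i Fin.< w j) where

  private
    τ : Fin n → Fin n
    τ = transpose i j

    w′ : Fin n → Fin n
    w′ = w ∘ τ

    τ-injective : ∀ {x y} → τ x ≡ τ y → x ≡ y
    τ-injective {x} {y} e =
      trans (sym (transpose-involutive i j x)) (trans (cong τ e) (transpose-involutive i j y))

  -- The values of an inversion (a , b) of w sit in w′ at positions τ a and τ b; when these are
  -- out of order (possible only when a or b is i or j), (a , b) is itself an inversion of w′.
  carry : Fin n × Fin n → Fin n × Fin n
  carry (a , b) with τ a <? τ b
  ... | yes _ = τ a , τ b
  ... | no  _ = a , b

  inversion-kept : ∀ {a b} → a Fin.< b → w b Fin.< w a → ¬ τ a Fin.< τ b → w′ b Fin.< w′ a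
  inversion-kept {a} {b} a<b wb<wa τa≮τb with transposeView i j a | transposeView i j b
  ... | at-i | at-i = contradiction a<b (<-irrefl refl)
  ... | at-i | at-j = contradiction wb<wa (<-asym wi<wj)
  ... | at-i | apart b≢i b≢j
    rewrite transpose-matchˡ i j | transpose-apart i j b≢i b≢j = <-trans wb<wa wi<wj
  ... | at-j | at-i = contradiction a<b (<-asym i<j)
  ... | at-j | at-j = contradiction a<b (<-irrefl refl)
  ... | at-j | apart b≢i b≢j
    rewrite transpose-matchʳ i j | transpose-apart i j b≢i b≢j =
    contradiction (<-trans i<j a<b) τa≮τb
  ... | apart a≢i a≢j | at-i
    rewrite transpose-apart i j a≢i a≢j | transpose-matchˡ i j =
    contradiction (<-trans a<b i<j) τa≮τb
  ... | apart a≢i a≢j | at-j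
    rewrite transpose-apart i j a≢i a≢j | transpose-matchʳ i j = <-trans wi<wj wb<wa
  ... | apart a≢i a≢j | apart b≢i b≢j
    rewrite transpose-apart i j a≢i a≢j | transpose-apart i j b≢i b≢j = contradiction a<b τa≮τb

  carry-inversion : ∀ {p} → Inversion w p → Inversion w′ (carry p)
  carry-inversion {a , b} (a<b , wb<wa) with τ a <? τ b
  ... | yes τa<τb
    rewrite transpose-involutive i j a | transpose-involutive i j b = τa<τb , wb<wa
  ... | no τa≮τb = a<b , inversion-kept a<b wb<wa τa≮τb

  carry-injective : ∀ {p p′} → Inversion w p → Inversion w p′ → carry p ≡ carry p′ → p ≡ p′
  carry-injective {a , b} {a′ , b′} (a<b , _) (a′<b′ , _) eq with τ a <? τ b | τ a′ <? τ b′
  ... | yes _ | yes _ = cong₂ _,_ (τ-injective (cong proj₁ eq)) (τ-injective (cong proj₂ eq))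
  ... | no _  | no _  = eq
  ... | yes _ | no τa′≮τb′ with refl ← eq
    rewrite transpose-involutive i j a | transpose-involutive i j b = contradiction a<b τa′≮τb′
  ... | no τa≮τb | yes _ with refl ← eq
    rewrite transpose-involutive i j a′ | transpose-involutive i j b′ = contradiction a′<b′ τa≮τb

  carry-≢-ij : ∀ {p} → Inversion w p → carry p ≢ (i , j)
  carry-≢-ij {a , b} (a<b , wb<wa) eq with τ a <? τ b
  ... | no _ with refl ← eq = <-asym wi<wj wb<wa
  ... | yes _ = <-asym i<j (subst₂ Fin._<_ a≡j b≡i a<b)
    where
    a≡j : a ≡ j
    a≡j = τ-injective (trans (cong proj₁ eq) (sym (transpose-matchʳ i j)))
    b≡i : b ≡ i
    b≡i = τ-injective (trans (cong proj₂ eq) (sym (transpose-matchˡ i j)))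

  inv-transpose : inv w < inv w′
  inv-transpose = begin-strict
    inv w                                ≡⟨ inv≡count-inversions w ⟩
    count (inversion? w) pairs           ≤⟨ count-≤-by-injection (inversion? w) _≟ᵖ_ Carries
                                              carries-injective pairs! pairs! inversion′? image ⟩
    count inversion′? pairs              <⟨ n<1+n _ ⟩
    suc (count inversion′? pairs)        ≡⟨ count-remove⁺ (inversion? w′) pairs!
                                              (∈-positionPairs (i , j)) ij-inversion ⟨
    count (inversion? w′) pairs          ≡⟨ inv≡count-inversions w′ ⟨
    inv w′                               ∎
    where
    open ≤-Reasoning
    open Removal (_≟ᵖ_ {n})
    pairs = positionPairs n
    pairs! = positionPairs-unique n
    inversion′? = inversion? w′ ∖? (i , j)
    Carries : Fin n × Fin n → Fin n × Fin n → Set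
    Carries p q = Inversion w p × carry p ≡ q
    carries-injective : ∀ {p p′ q} → Carries p q → Carries p′ q → p ≡ p′
    carries-injective (p-inv , refl) (p′-inv , eq) = carry-injective p-inv p′-inv (sym eq)
    image : ∀ {p} → p ∈ pairs → Inversion w p →
            ∃[ q ] q ∈ pairs × (q ≢ (i , j) × Inversion w′ q) × Carries p q
    image {p} _ p-inv =
      carry p , ∈-positionPairs _ , (carry-≢-ij p-inv , carry-inversion p-inv) , p-inv , refl
    ij-inversion : Inversion w′ (i , j)
    ij-inversion rewrite transpose-matchˡ i j | transpose-matchʳ i j = i<j , wi<wj

InCorner : ∀ {n} → (Fin n → Fin n) → Fin n → ℕ → Pred (Fin n) 0ℓ
InCorner w r k a = a Fin.≤ r × k ≤ toℕ (w a)

inCorner? : ∀ {n} (w : Fin n → Fin n) r k → Decidable (InCorner w r k)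
inCorner? w r k a = (a ≤? r) ×-dec (k ℕ.≤? toℕ (w a))

InCorner-resp : ∀ {n} {w w′ : Fin n → Fin n} {r k a} →
  w a ≡ w′ a → InCorner w r k a → InCorner w′ r k a
InCorner-resp {k = k} wa≡w′a (a≤r , k≤wa) = a≤r , subst (λ x → k ≤ toℕ x) wa≡w′a k≤wa

-- rank w r k is w[r, k] of Björner–Brenti, whose tableau criterion (Thm. 2.1.5) says that ≤rank
-- is Bruhat order.
rank : ∀ {n} → (Fin n → Fin n) → Fin n → ℕ → ℕ
rank {n} w r k = count (inCorner? w r k) (allFin n)

_≤rank_ : ∀ {n} → (Fin n → Fin n) → (Fin n → Fin n) → Set
u ≤rank v = ∀ r k → rank u r k ≤ rank v r k

InWindow : ∀ {n} → (Fin n → Fin n) → Fin n → Fin n → Fin n → ℕ → Set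
InWindow w i j r k = i Fin.≤ r × ¬ j Fin.≤ r × ¬ k ≤ toℕ (w i) × k ≤ toℕ (w j)

inWindow? : ∀ {n} (w : Fin n → Fin n) i j r k → Dec (InWindow w i j r k)
inWindow? w i j r k =
  (i ≤? r) ×-dec ¬? (j ≤? r) ×-dec ¬? (k ℕ.≤? toℕ (w i)) ×-dec (k ℕ.≤? toℕ (w j))

rank-transpose : ∀ {n} (w : Fin n → Fin n) {i j} → i Fin.< j → w i Fin.< w j → ∀ r k →
  rank (w ∘ transpose i j) r k ≡ indicator (inWindow? w i j r k) + rank w r k
rank-transpose {n} w {i} {j} i<j wi<wj r k = begin
  rank (w ∘ τ) r k
    ≡⟨ pivots (w ∘ τ) ⟩
  [ i≤r? ∧ k≤w (τ i) ] + ([ j≤r? ∧ k≤w (τ j) ] + rest (w ∘ τ))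
    ≡⟨ cong₂ (λ x y → [ i≤r? ∧ k≤w x ] + ([ j≤r? ∧ k≤w y ] + rest (w ∘ τ)))
             (transpose-matchˡ i j) (transpose-matchʳ i j) ⟩
  [ i≤r? ∧ k≤w j ] + ([ j≤r? ∧ k≤w i ] + rest (w ∘ τ))
    ≡⟨ cong (λ m → [ i≤r? ∧ k≤w j ] + ([ j≤r? ∧ k≤w i ] + m)) rest-transpose ⟩
  [ i≤r? ∧ k≤w j ] + ([ j≤r? ∧ k≤w i ] + rest w)
    ≡⟨ +-assoc [ i≤r? ∧ k≤w j ] _ _ ⟨
  ([ i≤r? ∧ k≤w j ] + [ j≤r? ∧ k≤w i ]) + rest w
    ≡⟨ cong (_+ rest w) (indicator-exchange i≤r? j≤r? (k≤w i) (k≤w j)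
                           (≤-trans (<⇒≤ i<j)) (λ k≤wi → ≤-trans k≤wi (<⇒≤ wi<wj))) ⟩
  (window + ([ i≤r? ∧ k≤w i ] + [ j≤r? ∧ k≤w j ])) + rest w
    ≡⟨ +-assoc window _ _ ⟩
  window + (([ i≤r? ∧ k≤w i ] + [ j≤r? ∧ k≤w j ]) + rest w)
    ≡⟨ cong (window +_) (+-assoc [ i≤r? ∧ k≤w i ] _ _) ⟩
  window + ([ i≤r? ∧ k≤w i ] + ([ j≤r? ∧ k≤w j ] + rest w))
    ≡⟨ cong (window +_) (pivots w) ⟨
  window + rank w r k ∎
  where
  open ≡-Reasoning
  open Removal (_≟_ {n})
  τ = transpose i j
  i≤r? = i ≤? r
  j≤r? = j ≤? r
  k≤w : ∀ x → Dec (k ≤ toℕ (w x))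
  k≤w x = k ℕ.≤? toℕ (w x)
  [_∧_] : ∀ {ℓ ℓ′} {P : Set ℓ} {Q : Set ℓ′} → Dec P → Dec Q → ℕ
  [ P? ∧ Q? ] = indicator (P? ×-dec Q?)
  window = indicator (inWindow? w i j r k)
  rest : (Fin n → Fin n) → ℕ
  rest w = count (inCorner? w r k ∖? i ∖? j) (allFin n)
  pivots : ∀ w → rank w r k ≡ indicator (inCorner? w r k i)
                                + (indicator (inCorner? w r k j) + rest w)
  pivots w = count-remove₂ (inCorner? w r k) (allFin⁺ n) (∈-allFin i) (∈-allFin j)
                           (λ j≡i → <-irrefl (sym j≡i) i<j)
  rest-transpose : rest (w ∘ τ) ≡ rest w
  rest-transpose = count-cong (inCorner? (w ∘ τ) r k ∖? i ∖? j) (inCorner? w r k ∖? i ∖? j)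
    ( (λ (a≢j , a≢i , c) → a≢j , a≢i , InCorner-resp {w = w ∘ τ} {w} (fixed a≢i a≢j) c)
    , (λ (a≢j , a≢i , c) → a≢j , a≢i , InCorner-resp {w = w} {w ∘ τ} (sym (fixed a≢i a≢j)) c))
    (allFin n)
    where
    fixed : ∀ {a} → a ≢ i → a ≢ j → w (τ a) ≡ w a
    fixed a≢i a≢j = cong w (transpose-apart i j a≢i a≢j)

module Climb {n} (π σ : Permutation′ n) (π≤σ : (π ⟨$⟩ʳ_) ≤rank (σ ⟨$⟩ʳ_))
             {I : Fin n} (differ : π ⟨$⟩ʳ I ≢ σ ⟨$⟩ʳ I)
             (agree : ∀ {a} → a Fin.< I → π ⟨$⟩ʳ a ≡ σ ⟨$⟩ʳ a) where

  private
    u v : Fin n → Fin n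
    u = π ⟨$⟩ʳ_
    v = σ ⟨$⟩ʳ_
    open Removal (_≟_ {n})

  uI<vI : u I Fin.< v I
  uI<vI = Finₚ.≤∧≢⇒< uI≤vI differ
    where
    k = toℕ (u I)
    below : (Fin n → Fin n) → ℕ
    below w = count (inCorner? w I k ∖? I) (allFin n)
    rank-at-I : ∀ w → rank w I k ≡ indicator (inCorner? w I k I) + below w
    rank-at-I w = count-remove (inCorner? w I k) (allFin⁺ n) (∈-allFin I)
    below-agree : below u ≡ below v
    below-agree = count-cong (inCorner? u I k ∖? I) (inCorner? v I k ∖? I)
      ( (λ (a≢I , c) → a≢I , InCorner-resp {w = u} {v} (agree (Finₚ.≤∧≢⇒< (proj₁ c) a≢I)) c)
      , (λ (a≢I , c) → a≢I , InCorner-resp {w = v} {u} (sym (agree (Finₚ.≤∧≢⇒< (proj₁ c) a≢I))) c))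
      (allFin n)
    uI≤vI : u I Fin.≤ v I
    uI≤vI with u I ≤? v I
    ... | yes uI≤vI = uI≤vI
    ... | no uI≰vI = contradiction (π≤σ I k) (<⇒≱ (begin-strict
      rank v I k
        ≡⟨ rank-at-I v ⟩
      indicator (inCorner? v I k I) + below v
        ≡⟨ cong (_+ below v) (indicator-no (inCorner? v I k I) (uI≰vI ∘ proj₂)) ⟩
      below v
        ≡⟨ below-agree ⟨
      below u
        <⟨ n<1+n _ ⟩
      suc (below u)
        ≡⟨ cong (_+ below u) (indicator-yes (inCorner? u I k I) (≤-refl , ≤-refl)) ⟨
      indicator (inCorner? u I k I) + below u
        ≡⟨ rank-at-I u ⟨
      rank u I k ∎))
      where open ≤-Reasoning

  Candidate : Pred (Fin n) 0ℓ
  Candidate a = I Fin.< a × u I Fin.< u a × u a Fin.≤ v I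

  candidate? : Decidable Candidate
  candidate? a = (I <? a) ×-dec (u I <? u a) ×-dec (u a ≤? v I)

  candidate-exists : Candidate (π ⟨$⟩ˡ v I)
  candidate-exists = I<x , subst (u I Fin.<_) (sym ux≡vI) uI<vI , Finₚ.≤-reflexive ux≡vI
    where
    x = π ⟨$⟩ˡ v I
    ux≡vI : u x ≡ v I
    ux≡vI = inverseʳ π
    x≮I : ¬ x Fin.< I
    x≮I x<I = <-irrefl (Injection.injective (↔⇒↣ σ) (trans (sym (agree x<I)) ux≡vI)) x<I
    I<x : I Fin.< x
    I<x = Finₚ.≤∧≢⇒< (≮⇒≥ x≮I) (λ I≡x → differ (trans (cong u I≡x) ux≡vI))

  private
    first-candidate : ∃[ j ] ¬ ¬ Candidate j × (∀ {a} → a Fin.< j → ¬ Candidate a)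
    first-candidate =
      least-counterexample (λ a → ¬? (candidate? a)) (λ none → none _ candidate-exists)

  j : Fin n
  j = proj₁ first-candidate

  j-candidate : Candidate j
  j-candidate = decidable-stable (candidate? j) (proj₁ (proj₂ first-candidate))

  no-candidate-before-j : ∀ {a} → a Fin.< j → ¬ Candidate a
  no-candidate-before-j = proj₂ (proj₂ first-candidate)

  rank-gap : ∀ {r k} → I Fin.≤ r → r Fin.< j → toℕ (u I) < k → k ≤ toℕ (u j) →
    suc (rank u r k) ≤ rank v r k
  rank-gap {r} {k} I≤r r<j uI<k k≤uj = begin
    suc (rank u r k)      ≡⟨ cong suc (count-split (inCorner? u r k) (high? u) (allFin n)) ⟩
    suc (high u + low u)  ≡⟨ +-suc (high u) (low u) ⟨
    high u + suc (low u)  ≤⟨ +-mono-≤ high-≤ low-< ⟩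
    high v + low v        ≡⟨ count-split (inCorner? v r k) (high? v) (allFin n) ⟨
    rank v r k            ∎
    where
    open ≤-Reasoning
    V = toℕ (v I)
    k≤V : k ≤ V
    k≤V = ≤-trans k≤uj (proj₂ (proj₂ j-candidate))
    high? : (w : Fin n → Fin n) → Decidable (λ a → V < toℕ (w a))
    high? w a = V ℕ.<? toℕ (w a)
    high low : (Fin n → Fin n) → ℕ
    high w = count (high? w ∩? inCorner? w r k) (allFin n)
    low w = count (∁? (high? w) ∩? inCorner? w r k) (allFin n)
    high-≤ : high u ≤ high v
    high-≤ = begin
      high u            ≤⟨ count-mono (high? u ∩? inCorner? u r k) (inCorner? u r (suc V))
                             (λ (V<ua , a≤r , _) → a≤r , V<ua) (allFin n) ⟩
      rank u r (suc V)  ≤⟨ π≤σ r (suc V) ⟩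
      rank v r (suc V)  ≤⟨ count-mono (inCorner? v r (suc V)) (high? v ∩? inCorner? v r k)
                             (λ (a≤r , V<va) → V<va , a≤r , ≤-trans k≤V (<⇒≤ V<va)) (allFin n) ⟩
      high v            ∎
    -- Below the value v I the two ranks count the same positions a < I, and v also counts I.
    low-< : suc (low u) ≤ low v
    low-< = begin
      suc (low u)     ≤⟨ s≤s (count-mono (∁? (high? u) ∩? inCorner? u r k) low-v∖I? low-moves
                                         (allFin n)) ⟩
      suc (count low-v∖I? (allFin n))
                      ≡⟨ count-remove⁺ (∁? (high? v) ∩? inCorner? v r k) (allFin⁺ n) (∈-allFin I)
                                       (n≮n V , I≤r , k≤V) ⟨
      low v           ∎
      where
      low-v∖I? = (∁? (high? v) ∩? inCorner? v r k) ∖? I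
      low-moves : ∀ {a} → ¬ V < toℕ (u a) × InCorner u r k a →
                  a ≢ I × ¬ V < toℕ (v a) × InCorner v r k a
      low-moves {a} (V≮ua , c@(a≤r , k≤ua)) =
        a≢I , subst (λ x → ¬ V < toℕ x) ua≡va V≮ua , InCorner-resp {w = u} {v} ua≡va c
        where
        a≢I : a ≢ I
        a≢I refl = <⇒≱ uI<k k≤ua
        I≮a : ¬ I Fin.< a
        I≮a I<a =
          no-candidate-before-j (≤-<-trans a≤r r<j) (I<a , <-≤-trans uI<k k≤ua , ≮⇒≥ V≮ua)
        ua≡va : u a ≡ v a
        ua≡va = agree (Finₚ.≤∧≢⇒< (≮⇒≥ I≮a) a≢I)

  π′ : Permutation′ n
  π′ = Perm.transpose I j ∘ₚ π

  private
    I<j : I Fin.< j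
    I<j = proj₁ j-candidate

    uI<uj : u I Fin.< u j
    uI<uj = proj₁ (proj₂ j-candidate)

  inv-increases : inv u < inv (π′ ⟨$⟩ʳ_)
  inv-increases = inv-transpose u I<j uI<uj

  step : BruhatStep u (π′ ⟨$⟩ʳ_)
  step = I , j , I<j , (λ _ → refl) , inv-increases

  π′≤σ : (π′ ⟨$⟩ʳ_) ≤rank v
  π′≤σ r k =
    subst (_≤ rank v r k) (sym (rank-transpose u I<j uI<uj r k)) (rise (inWindow? u I j r k))
    where
    rise : (window? : Dec (InWindow u I j r k)) → indicator window? + rank u r k ≤ rank v r k
    rise (yes (I≤r , j≰r , k≰uI , k≤uj)) = rank-gap I≤r (≰⇒> j≰r) (≰⇒> k≰uI) k≤uj
    rise (no _)                          = π≤σ r k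

≤rank⇒≤Bruhat : ∀ {n} (π σ : Permutation′ n) → (π ⟨$⟩ʳ_) ≤rank (σ ⟨$⟩ʳ_) → π ≤Bruhat σ
≤rank⇒≤Bruhat {n} π σ = climb (length (positionPairs n)) π (m≤n+m _ (inv (π ⟨$⟩ʳ_)))
  where
  -- Every step raises inv, which never exceeds length (positionPairs n).
  climb : ∀ d π → length (positionPairs n) ≤ inv (π ⟨$⟩ʳ_) + d →
          (π ⟨$⟩ʳ_) ≤rank (σ ⟨$⟩ʳ_) → π ≤Bruhat σ
  climb d π bound π≤σ with all? (λ a → π ⟨$⟩ʳ a ≟ σ ⟨$⟩ʳ a)
  ... | yes π≗σ = ≤ᴮ-refl π≗σ
  ... | no π≉σ with I , differ , agree ← least-counterexample (λ a → π ⟨$⟩ʳ a ≟ σ ⟨$⟩ʳ a) π≉σ =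
    ≤ᴮ-step step (next d bound)
    where
    open Climb π σ π≤σ differ agree
    next : ∀ d → length (positionPairs n) ≤ inv (π ⟨$⟩ʳ_) + d → π′ ≤Bruhat σ
    next zero bound = contradiction
      (≤-trans (inv-≤-length (π′ ⟨$⟩ʳ_)) (subst (_ ≤_) (+-identityʳ _) bound))
      (<⇒≱ inv-increases)
    next (suc d) bound = climb d π′ (begin
      length (positionPairs n)  ≤⟨ bound ⟩
      inv (π ⟨$⟩ʳ_) + suc d     ≡⟨ +-suc _ d ⟩
      suc (inv (π ⟨$⟩ʳ_)) + d   ≤⟨ +-monoˡ-≤ d inv-increases ⟩
      inv (π′ ⟨$⟩ʳ_) + d        ∎) π′≤σ
      where open ≤-Reasoning

inc-toℕ : ∀ {n} {i i′ : Fin n} → inc i ≡ just i′ → toℕ i′ ≡ suc (toℕ i)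
inc-toℕ {suc zero}    {zero}          ()
inc-toℕ {suc (suc n)} {zero}          refl = refl
inc-toℕ {suc (suc n)} {suc i} {i′} eq with inc i in eq′
inc-toℕ {suc (suc n)} {suc i} {suc i″} refl | just i″ = cong suc (inc-toℕ eq′)

topRow-≤ : ∀ {n} (j i : Fin n) → topRow j Fin.≤ i
topRow-≤ {suc n} _ _ = z≤n

move-down⇒hasBottom : ∀ t s → move t s ≡ just goDown → hasBottom t ≡ true
move-down⇒hasBottom vert       _        _ = refl
move-down⇒hasBottom cross      _        _ = refl
move-down⇒hasBottom elbow      _        _ = refl
move-down⇒hasBottom empty      fromTop  ()
move-down⇒hasBottom empty      fromLeft ()
move-down⇒hasBottom horiz      fromTop  ()
move-down⇒hasBottom horiz      fromLeft ()
move-down⇒hasBottom pivotElbow fromTop  ()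
move-down⇒hasBottom pivotElbow fromLeft ()

module _ {n} (D : Tiling n) where

  walk-exitsRight-unique : ∀ f g {r c s a b} →
    proj₂ (walk f D r c s) ≡ exitsRight a → proj₂ (walk g D r c s) ≡ exitsRight b → a ≡ b
  walk-exitsRight-unique zero    _       ()     _
  walk-exitsRight-unique (suc f) zero    _      ()
  walk-exitsRight-unique (suc f) (suc g) {r} {c} {s} exits exits′ with move (D r c) s
  ... | nothing = contradiction exits λ ()
  ... | just goDown with inc r
  ...   | nothing = contradiction exits λ ()
  ...   | just r′ = walk-exitsRight-unique f g exits exits′
  walk-exitsRight-unique (suc f) (suc g) {r} {c} {s} exits exits′ | just goRight with inc c
  ...   | nothing = exitsRight-injective (trans (sym exits) exits′)
    where
    exitsRight-injective : ∀ {a b} → exitsRight {n} a ≡ exitsRight b → a ≡ b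
    exitsRight-injective refl = refl
  ...   | just c′ = walk-exitsRight-unique f g exits exits′

  CrossesBelow : Fin n → Fin n → Fin n → Set
  CrossesBelow i c a = hasBottom (D i c) ≡ true ×
    ∃[ i′ ] ∃[ f ] inc i ≡ just i′ × proj₂ (walk f D i′ c fromTop) ≡ exitsRight a

  crossesBelow-unique : ∀ {i c a b} → CrossesBelow i c a → CrossesBelow i c b → a ≡ b
  crossesBelow-unique (_ , _ , f , steps , exits) (_ , _ , g , steps′ , exits′)
    with refl ← trans (sym steps) steps′ = walk-exitsRight-unique f g exits exits′

  walk-crossesBelow : ∀ f {r c s i a} → r Fin.≤ i → i Fin.< a →
    proj₂ (walk f D r c s) ≡ exitsRight a → ∃[ c′ ] c Fin.≤ c′ × CrossesBelow i c′ a
  walk-crossesBelow zero _ _ ()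
  walk-crossesBelow (suc f) {r} {c} {s} {i} r≤i i<a exits with move (D r c) s in moves
  ... | nothing = contradiction exits λ ()
  ... | just goDown with inc r in steps
  ...   | nothing = contradiction exits λ ()
  ...   | just r′ with r ≟ i
  ...     | yes refl = c , ≤-refl , move-down⇒hasBottom _ _ moves , r′ , f , steps , exits
  ...     | no r≢i = walk-crossesBelow f r′≤i i<a exits
    where
    r′≤i : r′ Fin.≤ i
    r′≤i = subst (_≤ toℕ i) (sym (inc-toℕ steps)) (Finₚ.≤∧≢⇒< r≤i r≢i)
  walk-crossesBelow (suc f) {r} {c} {s} {i} r≤i i<a exits | just goRight with inc c in steps
  ...   | nothing = contradiction exits (λ { refl → <⇒≱ i<a r≤i })
  ...   | just c′ with c″ , c′≤c″ , crosses ← walk-crossesBelow f r≤i i<a exits =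
    c″ , ≤-trans (subst (toℕ c ≤_) (sym (inc-toℕ steps)) (n≤1+n _)) c′≤c″ , crosses

rothe-hasBottom : ∀ {n} {π : Permutation′ n} {D : Tiling n} → IsRothePipeDream π D →
  ∀ {i c} → hasBottom (D i c) ≡ true → i Fin.< π ⟨$⟩ˡ c
rothe-hasBottom {π = π} {D} (_ , pivot , empty-rule , horiz-rule , _) {i} {c} bottom
  with Finₚ.<-cmp i (π ⟨$⟩ˡ c)
... | tri< i<pivotRow _ _ = i<pivotRow
... | tri≈ _ refl _ = contradiction (subst (λ t → hasBottom t ≡ true) pivot-tile bottom) λ ()
  where
  pivot-tile : D (π ⟨$⟩ˡ c) c ≡ pivotElbow
  pivot-tile = trans (cong (D _) (sym (inverseʳ π))) (pivot _)
... | tri> _ _ pivotRow<i with Finₚ.<-cmp c (π ⟨$⟩ʳ i)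
...   | tri< c<πi _ _ rewrite empty-rule i c pivotRow<i c<πi = contradiction bottom λ ()
...   | tri> _ _ πi<c rewrite horiz-rule i c pivotRow<i πi<c = contradiction bottom λ ()
...   | tri≈ _ refl _ = contradiction (inverseˡ π) (Finₚ.<⇒≢ pivotRow<i)

pipeDream⇒≤rank : ∀ {n} {π σ : Permutation′ n} {D : Tiling n} →
  IsRothePipeDream π D → HasExitPermutation D σ → (π ⟨$⟩ʳ_) ≤rank (σ ⟨$⟩ʳ_)
pipeDream⇒≤rank {n} {π} {σ} {D} rothe exit r k = +-cancelʳ-≤ (beyond σ) _ _ (begin
  rank (π ⟨$⟩ʳ_) r k + beyond σ  ≤⟨ +-monoʳ-≤ (rank (π ⟨$⟩ʳ_) r k) beyond-≤ ⟩
  rank (π ⟨$⟩ʳ_) r k + beyond π  ≡⟨ total π ⟩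
  count atLeast? (allFin n)      ≡⟨ total σ ⟨
  rank (σ ⟨$⟩ʳ_) r k + beyond σ  ∎)
  where
  open ≤-Reasoning
  atLeast? : Decidable (λ b → k ≤ toℕ b)
  atLeast? b = k ℕ.≤? toℕ b
  beyond? : (τ : Permutation′ n) → Decidable (λ a → ¬ a Fin.≤ r × k ≤ toℕ (τ ⟨$⟩ʳ a))
  beyond? τ = ∁? (_≤? r) ∩? (atLeast? ∘ (τ ⟨$⟩ʳ_))
  beyond : Permutation′ n → ℕ
  beyond τ = count (beyond? τ) (allFin n)
  total : ∀ τ → rank (τ ⟨$⟩ʳ_) r k + beyond τ ≡ count atLeast? (allFin n)
  total τ = trans (sym (count-split (atLeast? ∘ (τ ⟨$⟩ʳ_)) (_≤? r) (allFin n)))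
                  (count-permute τ atLeast?)
  crossing : ∀ {b} → b ∈ allFin n → ¬ b Fin.≤ r × k ≤ toℕ (σ ⟨$⟩ʳ b) →
    ∃[ a ] a ∈ allFin n × (¬ a Fin.≤ r × k ≤ toℕ (π ⟨$⟩ʳ a)) × CrossesBelow D r (π ⟨$⟩ʳ a) b
  crossing {b} _ (b≰r , k≤σb)
    with c , σb≤c , crosses ← walk-crossesBelow D (2 * n) (topRow-≤ _ r) (≰⇒> b≰r) (exit b) =
    π ⟨$⟩ˡ c , ∈-allFin _ ,
    ( <⇒≱ (rothe-hasBottom {π = π} {D} rothe (proj₁ crosses))
    , subst (λ x → k ≤ toℕ x) c≡π[π⁻¹c] (≤-trans k≤σb σb≤c)) ,
    subst (λ x → CrossesBelow D r x b) c≡π[π⁻¹c] crosses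
    where
    c≡π[π⁻¹c] : c ≡ π ⟨$⟩ʳ (π ⟨$⟩ˡ c)
    c≡π[π⁻¹c] = sym (inverseʳ π)
  beyond-≤ : beyond σ ≤ beyond π
  beyond-≤ = count-≤-by-injection (beyond? σ) _≟_ (λ b a → CrossesBelow D r (π ⟨$⟩ʳ a) b)
    (crossesBelow-unique D) (allFin⁺ n) (allFin⁺ n) (beyond? π) crossing

proposition3p8 : ∀ (n : ℕ) (u v : Permutation′ n) →
    (∃[ D ] (IsRothePipeDream u D × Reduced D × HasExitPermutation D v)) →
    u ≤Bruhat v
proposition3p8 n u v (D , rothe , _ , exit) =
  ≤rank⇒≤Bruhat u v (pipeDream⇒≤rank {π = u} {v} {D} rothe exit)
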